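{- Let $\#$ be a parametrized monad on a category $\mathbf{C}$ with finite coproducts such that for every object $X$ a final coalgebra $\mathsf{out}_X:\Phi X\to X\#\Phi X$ of $X\#(-)$ exists. Let $e:X\to B\#X$ and $f:B\to A\#\Phi A$. Then \[\mathrm{coit}(e,f)=(\mathsf{out}_A^{ -1}\circ f)^{*}\circ\mathrm{coit}\, e,\] where $\mathrm{coit}\,e:X\to\Phi B$ is the unique coalgebra morphism from $(X,e)$ to $(\Phi B,\mathsf{out}_B)$.
   Context: A parametrized monad is a bifunctor $\#$ such that each $(-)\#X$ is a monad with unit $u^X_A:A\to A\#X$ and multiplication $m^X_A:(A\#X)\#X\to A\#X$, and for each $f:X\to Y$ the family $(\mathrm{id}_Z\#f)_Z$ is a monad morphism. For $e:X\to B\#X$ and $f:B\to A\#\Phi A$, $\mathrm{coit}(e,f):X\to\Phi A$ denotes the unique $h$ with $\mathsf{out}_A\circ h=m^{\Phi A}_A\circ(f\#h)\circ e$ (it exists and is unique). The monad structure on $\Phi$: unit $\eta^\nu_X=\mathsf{out}_X^{ -1}\circ u^{\Phi X}_X$, and for $g:X\to\Phi Y$, the Kleisli lifting $g^*:\Phi X\to\Phi Y$ is $\mathrm{coit}((g\#\mathrm{id})\circ\mathsf{out}_X,\mathsf{out}_Y)$, i.e. the unique morphism with $\mathsf{out}_Y\circ g^*=m^{\Phi Y}_Y\circ((\mathsf{out}_Y\circ g)\# g^*)\circ\mathsf{out}_X$. -}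

module Defs where

open import Level using (Level; _⊔_; suc)
open import Relation.Binary using (IsEquivalence)

record Category (o ℓ e : Level) : Set (suc (o ⊔ ℓ ⊔ e)) where
  infixr 9 _∘_
  infix  4 _≈_
  field
    Obj   : Set o
    Hom   : Obj → Obj → Set ℓ
    _≈_   : ∀ {A B} → Hom A B → Hom A B → Set e
    id    : ∀ {A} → Hom A A
    _∘_   : ∀ {A B C} → Hom B C → Hom A B → Hom A C
    ≈-equiv   : ∀ {A B} → IsEquivalence (_≈_ {A} {B})
    ∘-resp-≈  : ∀ {A B C} {f f' : Hom B C} {g g' : Hom A B} →
                f ≈ f' → g ≈ g' → f ∘ g ≈ f' ∘ g'
    identityˡ : ∀ {A B} {f : Hom A B} → id ∘ f ≈ f
    identityʳ : ∀ {A B} {f : Hom A B} → f ∘ id ≈ f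
    assoc     : ∀ {A B C D} {f : Hom A B} {g : Hom B C} {h : Hom C D} →
                (h ∘ g) ∘ f ≈ h ∘ (g ∘ f)

module _ {o ℓ e : Level} (C : Category o ℓ e) where
  open Category C

  record FiniteCoproducts : Set (o ⊔ ℓ ⊔ e) where
    infixr 6 _⊕_
    field
      𝟘        : Obj
      ¡        : ∀ {A} → Hom 𝟘 A
      ¡-unique : ∀ {A} (h : Hom 𝟘 A) → h ≈ ¡
      _⊕_      : Obj → Obj → Obj
      inl      : ∀ {A B} → Hom A (A ⊕ B)
      inr      : ∀ {A B} → Hom B (A ⊕ B)
      [_,_]    : ∀ {A B Z} → Hom A Z → Hom B Z → Hom (A ⊕ B) Z
      inl-comm : ∀ {A B Z} {f : Hom A Z} {g : Hom B Z} → [ f , g ] ∘ inl ≈ f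
      inr-comm : ∀ {A B Z} {f : Hom A Z} {g : Hom B Z} → [ f , g ] ∘ inr ≈ g
      []-unique : ∀ {A B Z} {f : Hom A Z} {g : Hom B Z} (h : Hom (A ⊕ B) Z) →
                  h ∘ inl ≈ f → h ∘ inr ≈ g → h ≈ [ f , g ]

  record ParametrizedMonad : Set (o ⊔ ℓ ⊔ e) where
    infixl 7 _#_ _#₁_
    field
      _#_   : Obj → Obj → Obj
      _#₁_  : ∀ {A A' X X'} → Hom A A' → Hom X X' → Hom (A # X) (A' # X')
      #-resp-≈ : ∀ {A A' X X'} {f f' : Hom A A'} {g g' : Hom X X'} →
                 f ≈ f' → g ≈ g' → f #₁ g ≈ f' #₁ g'
      #-identity : ∀ {A X} → (id {A} #₁ id {X}) ≈ id
      #-homomorphism : ∀ {A A' A'' X X' X''}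
                       {f : Hom A A'} {f' : Hom A' A''} {g : Hom X X'} {g' : Hom X' X''} →
                       (f' ∘ f) #₁ (g' ∘ g) ≈ (f' #₁ g') ∘ (f #₁ g)
      u : ∀ X A → Hom A (A # X)
      m : ∀ X A → Hom ((A # X) # X) (A # X)
      u-natural : ∀ {X A A'} {f : Hom A A'} → (f #₁ id {X}) ∘ u X A ≈ u X A' ∘ f
      m-natural : ∀ {X A A'} {f : Hom A A'} →
                  (f #₁ id {X}) ∘ m X A ≈ m X A' ∘ ((f #₁ id) #₁ id)
      m-u-left  : ∀ {X A} → m X A ∘ u X (A # X) ≈ id
      m-u-right : ∀ {X A} → m X A ∘ (u X A #₁ id) ≈ id
      m-assoc   : ∀ {X A} → m X A ∘ m X (A # X) ≈ m X A ∘ (m X A #₁ id)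
      mm-u : ∀ {X Y A} {f : Hom X Y} → (id {A} #₁ f) ∘ u X A ≈ u Y A
      mm-m : ∀ {X Y A} {f : Hom X Y} →
             (id {A} #₁ f) ∘ m X A ≈ m Y A ∘ ((id {A # Y} #₁ f) ∘ ((id {A} #₁ f) #₁ id {X}))

  module _ (PM : ParametrizedMonad) where
    open ParametrizedMonad PM

    record FinalCoalgebras : Set (o ⊔ ℓ ⊔ e) where
      field
        Φ    : Obj → Obj
        out  : ∀ X → Hom (Φ X) (X # Φ X)
        coit : ∀ {X Y} → Hom Y (X # Y) → Hom Y (Φ X)
        coit-eq     : ∀ {X Y} (e : Hom Y (X # Y)) →
                      out X ∘ coit e ≈ (id #₁ coit e) ∘ e
        coit-unique : ∀ {X Y} (e : Hom Y (X # Y)) (h : Hom Y (Φ X)) →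
                      out X ∘ h ≈ (id #₁ h) ∘ e → h ≈ coit e

      -- Inverse of out (Lambek's lemma): the coalgebra morphism from
      -- (X # Φ X, id # out X) to the final coalgebra.
      outInv : ∀ X → Hom (X # Φ X) (Φ X)
      outInv X = coit (id #₁ out X)

    module _ (FC : FinalCoalgebras) where
      open FinalCoalgebras FC

      record GeneralizedCoiteration : Set (o ⊔ ℓ ⊔ e) where
        field
          coit₂ : ∀ {X B A} → Hom X (B # X) → Hom B (A # Φ A) → Hom X (Φ A)
          coit₂-eq : ∀ {X B A} (e : Hom X (B # X)) (f : Hom B (A # Φ A)) →
                     out A ∘ coit₂ e f ≈ m (Φ A) A ∘ ((f #₁ coit₂ e f) ∘ e)
          coit₂-unique : ∀ {X B A} (e : Hom X (B # X)) (f : Hom B (A # Φ A))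
                         (h : Hom X (Φ A)) →
                         out A ∘ h ≈ m (Φ A) A ∘ ((f #₁ h) ∘ e) → h ≈ coit₂ e f

        _* : ∀ {X Y} → Hom X (Φ Y) → Hom (Φ X) (Φ Y)
        _* {X} {Y} g = coit₂ ((g #₁ id) ∘ out X) (out Y)

-- The Kleisli lifting g* is itself a generalised coiteration, along the
-- coalgebra out B relabelled by g. Precomposing with the coalgebra morphism
-- coit e : (X, e) → (Φ B, out B) therefore yields coit₂ ((g #₁ id) ∘ e) (out A),
-- and the relabelling can be pushed into the second argument, giving
-- coit₂ e (out A ∘ g). For g = outInv A ∘ f this is coit₂ e f by Lambek's lemma.
module Submission where

open import Defs
open import Level using (Level)
open import Relation.Binary using (IsEquivalence; Setoid)
import Relation.Binary.Reasoning.Setoid as SetoidReasoning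

module CategoryReasoning {o ℓ ε : Level} (C : Category o ℓ ε) where
  open Category C

  module _ {A B : Obj} where
    open IsEquivalence (≈-equiv {A} {B}) public
      renaming (refl to ≈-refl; sym to ≈-sym; trans to ≈-trans)

  homSetoid : Obj → Obj → Setoid ℓ ε
  homSetoid A B = record { Carrier = Hom A B ; _≈_ = _≈_ ; isEquivalence = ≈-equiv }

  module HomReasoning {A B : Obj} = SetoidReasoning (homSetoid A B)

  ∘-resp-≈ˡ : ∀ {A B D} {f f' : Hom B D} {g : Hom A B} → f ≈ f' → f ∘ g ≈ f' ∘ g
  ∘-resp-≈ˡ p = ∘-resp-≈ p ≈-refl

  ∘-resp-≈ʳ : ∀ {A B D} {f : Hom B D} {g g' : Hom A B} → g ≈ g' → f ∘ g ≈ f ∘ g'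
  ∘-resp-≈ʳ p = ∘-resp-≈ ≈-refl p

  cancelˡ : ∀ {A B D} {f : Hom B D} {f⁻¹ : Hom D B} {g : Hom A D} →
            f ∘ f⁻¹ ≈ id → f ∘ (f⁻¹ ∘ g) ≈ g
  cancelˡ p = ≈-trans (≈-sym assoc) (≈-trans (∘-resp-≈ˡ p) identityˡ)

module Bifunctor {o ℓ ε : Level} {C : Category o ℓ ε} (PM : ParametrizedMonad C) where
  open Category C
  open ParametrizedMonad PM
  open CategoryReasoning C

  #-merge-idʳ : ∀ {A A' X X' X''} {f : Hom A A'} {k : Hom X' X''} {h : Hom X X'} →
                (f #₁ k) ∘ (id #₁ h) ≈ f #₁ (k ∘ h)
  #-merge-idʳ = ≈-trans (≈-sym #-homomorphism) (#-resp-≈ identityʳ ≈-refl)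

  #-merge-idˡ : ∀ {A A' A'' X X'} {f : Hom A' A''} {g : Hom A A'} {k : Hom X X'} →
                (f #₁ k) ∘ (g #₁ id) ≈ (f ∘ g) #₁ k
  #-merge-idˡ = ≈-trans (≈-sym #-homomorphism) (#-resp-≈ ≈-refl identityʳ)

  #-interchange : ∀ {A A' X X'} {g : Hom A A'} {h : Hom X X'} →
                  (g #₁ id) ∘ (id #₁ h) ≈ (id #₁ h) ∘ (g #₁ id)
  #-interchange = ≈-trans #-merge-idʳ (≈-trans (#-resp-≈ (≈-sym identityˡ) identityˡ)
                                               (≈-sym #-merge-idˡ))

module Coiteration {o ℓ ε : Level} {C : Category o ℓ ε} {PM : ParametrizedMonad C}
    {FC : FinalCoalgebras C PM} (GC : GeneralizedCoiteration C PM FC) where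
  open Category C
  open ParametrizedMonad PM
  open FinalCoalgebras FC
  open GeneralizedCoiteration GC
  open CategoryReasoning C
  open Bifunctor PM

  IsCoalgebraMorphism : ∀ {B X Y} → Hom X (B # X) → Hom Y (B # Y) → Hom X Y → Set ε
  IsCoalgebraMorphism e d h = d ∘ h ≈ (id #₁ h) ∘ e

  relabel-isCoalgebraMorphism : ∀ {B B' X Y} (g : Hom B B') {e : Hom X (B # X)}
                                {d : Hom Y (B # Y)} {h : Hom X Y} →
                                IsCoalgebraMorphism e d h →
                                IsCoalgebraMorphism ((g #₁ id) ∘ e) ((g #₁ id) ∘ d) h
  relabel-isCoalgebraMorphism g {e} {d} {h} p = begin
    ((g #₁ id) ∘ d) ∘ h         ≈⟨ assoc ⟩
    (g #₁ id) ∘ (d ∘ h)         ≈⟨ ∘-resp-≈ʳ p ⟩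
    (g #₁ id) ∘ ((id #₁ h) ∘ e) ≈⟨ ≈-sym assoc ⟩
    ((g #₁ id) ∘ (id #₁ h)) ∘ e ≈⟨ ∘-resp-≈ˡ #-interchange ⟩
    ((id #₁ h) ∘ (g #₁ id)) ∘ e ≈⟨ assoc ⟩
    (id #₁ h) ∘ ((g #₁ id) ∘ e) ∎
    where open HomReasoning

  Lambek-outInv∘out : ∀ A → outInv A ∘ out A ≈ id
  Lambek-outInv∘out A =
    ≈-trans (coit-unique (out A) (outInv A ∘ out A) outInv∘out-isCoalgebraMorphism)
            (≈-sym (coit-unique (out A) id id-isCoalgebraMorphism))
    where
    outInv∘out-isCoalgebraMorphism : IsCoalgebraMorphism (out A) (out A) (outInv A ∘ out A)
    outInv∘out-isCoalgebraMorphism = begin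
      out A ∘ (outInv A ∘ out A)                 ≈⟨ ≈-sym assoc ⟩
      (out A ∘ outInv A) ∘ out A                 ≈⟨ ∘-resp-≈ˡ (coit-eq (id #₁ out A)) ⟩
      ((id #₁ outInv A) ∘ (id #₁ out A)) ∘ out A ≈⟨ ∘-resp-≈ˡ #-merge-idʳ ⟩
      (id #₁ (outInv A ∘ out A)) ∘ out A         ∎
      where open HomReasoning
    id-isCoalgebraMorphism : IsCoalgebraMorphism (out A) (out A) id
    id-isCoalgebraMorphism =
      ≈-trans identityʳ (≈-sym (≈-trans (∘-resp-≈ˡ #-identity) identityˡ))

  Lambek-out∘outInv : ∀ A → out A ∘ outInv A ≈ id
  Lambek-out∘outInv A = begin
    out A ∘ outInv A                 ≈⟨ coit-eq (id #₁ out A) ⟩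
    (id #₁ outInv A) ∘ (id #₁ out A) ≈⟨ #-merge-idʳ ⟩
    id #₁ (outInv A ∘ out A)         ≈⟨ #-resp-≈ ≈-refl (Lambek-outInv∘out A) ⟩
    id #₁ id                         ≈⟨ #-identity ⟩
    id                               ∎
    where open HomReasoning

  coit₂-resp-≈ : ∀ {X B A} (e : Hom X (B # X)) {f f' : Hom B (A # Φ A)} →
                 f ≈ f' → coit₂ e f ≈ coit₂ e f'
  coit₂-resp-≈ e {f} {f'} p = coit₂-unique e f' (coit₂ e f)
    (≈-trans (coit₂-eq e f) (∘-resp-≈ʳ (∘-resp-≈ˡ (#-resp-≈ p ≈-refl))))

  coit₂-∘-coalgebraMorphism : ∀ {X Y B A} {e : Hom X (B # X)} {d : Hom Y (B # Y)}
                              {h : Hom X Y} (f : Hom B (A # Φ A)) →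
                              IsCoalgebraMorphism e d h → coit₂ d f ∘ h ≈ coit₂ e f
  coit₂-∘-coalgebraMorphism {e = e} {d} {h} f p = coit₂-unique e f (k ∘ h) (begin
    out _ ∘ (k ∘ h)                      ≈⟨ ≈-sym assoc ⟩
    (out _ ∘ k) ∘ h                      ≈⟨ ∘-resp-≈ˡ (coit₂-eq d f) ⟩
    (m _ _ ∘ ((f #₁ k) ∘ d)) ∘ h         ≈⟨ assoc ⟩
    m _ _ ∘ (((f #₁ k) ∘ d) ∘ h)         ≈⟨ ∘-resp-≈ʳ assoc ⟩
    m _ _ ∘ ((f #₁ k) ∘ (d ∘ h))         ≈⟨ ∘-resp-≈ʳ (∘-resp-≈ʳ p) ⟩
    m _ _ ∘ ((f #₁ k) ∘ ((id #₁ h) ∘ e)) ≈⟨ ∘-resp-≈ʳ (≈-sym assoc) ⟩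
    m _ _ ∘ (((f #₁ k) ∘ (id #₁ h)) ∘ e) ≈⟨ ∘-resp-≈ʳ (∘-resp-≈ˡ #-merge-idʳ) ⟩
    m _ _ ∘ ((f #₁ (k ∘ h)) ∘ e)         ∎)
    where
    k = coit₂ d f
    open HomReasoning

  coit₂-relabel : ∀ {X B B' A} (e : Hom X (B # X)) (g : Hom B B')
                  (f : Hom B' (A # Φ A)) →
                  coit₂ ((g #₁ id) ∘ e) f ≈ coit₂ e (f ∘ g)
  coit₂-relabel e g f = ≈-sym (coit₂-unique ((g #₁ id) ∘ e) f k (begin
    out _ ∘ k                            ≈⟨ coit₂-eq e (f ∘ g) ⟩
    m _ _ ∘ (((f ∘ g) #₁ k) ∘ e)         ≈⟨ ∘-resp-≈ʳ (∘-resp-≈ˡ (≈-sym #-merge-idˡ)) ⟩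
    m _ _ ∘ (((f #₁ k) ∘ (g #₁ id)) ∘ e) ≈⟨ ∘-resp-≈ʳ assoc ⟩
    m _ _ ∘ ((f #₁ k) ∘ ((g #₁ id) ∘ e)) ∎))
    where
    k = coit₂ e (f ∘ g)
    open HomReasoning

  coit₂-as-Kleisli : ∀ {X B A} (e : Hom X (B # X)) (f : Hom B (A # Φ A)) →
                     coit₂ e f ≈ ((outInv A ∘ f) *) ∘ coit e
  coit₂-as-Kleisli {B = B} {A} e f = begin
    coit₂ e f                            ≈⟨ coit₂-resp-≈ e (≈-sym (cancelˡ (Lambek-out∘outInv A))) ⟩
    coit₂ e (out A ∘ g)                  ≈⟨ ≈-sym (coit₂-relabel e g (out A)) ⟩
    coit₂ ((g #₁ id) ∘ e) (out A)        ≈⟨ ≈-sym (coit₂-∘-coalgebraMorphism (out A)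
                                               (relabel-isCoalgebraMorphism g (coit-eq e))) ⟩
    coit₂ ((g #₁ id) ∘ out B) (out A) ∘ coit e ∎
    where
    g = outInv A ∘ f
    open HomReasoning

lemma4p19 : ∀ {o ℓ ε : Level} (C : Category o ℓ ε) (CP : FiniteCoproducts C)
    (PM : ParametrizedMonad C) (FC : FinalCoalgebras C PM)
    (GC : GeneralizedCoiteration C PM FC) →
    let open Category C
        open ParametrizedMonad PM
        open FinalCoalgebras FC
        open GeneralizedCoiteration GC
    in ∀ {X B A} (e : Hom X (B # X)) (f : Hom B (A # Φ A)) →
    coit₂ e f ≈ ((outInv A ∘ f) *) ∘ coit e
lemma4p19 C CP PM FC GC = Coiteration.coit₂-as-Kleisli GC
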